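{- Let $T$ be a $k$-clipped decision tree over Boolean variables and let $p\in[0,1]$. Then for every $t\in\mathbb{N}$, \[ \Pr_{\rho\sim\mathcal{R}_p}\big[\mathrm{depth}(T\restriction\rho)\ge t\big]\le (2pk2^k)^t. \]
   Context: $\mathcal{R}_p$ is the distribution on restrictions that independently sets each variable to $*$ (left free) with probability $p$, and to $0$ or to $1$ with probability $(1-p)/2$ each. For a decision tree $T$ and restriction $\rho$, $T\restriction\rho$ is obtained by replacing every subtree querying a variable $e$ with $\rho(e)=b\in\{0,1\}$ by its $b$-child subtree (recursively), keeping queries to variables with $\rho(e)=*$. Decision trees are proper (no variable queried twice on a branch) with leaves labelled in $\{0,1\}$. A decision tree is $k$-clipped if from every node of the tree there is a choice of at most $k$ decisions (edges) leading to a leaf.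
   Formalization: The parameter p ranges only over the rational numbers in $[0,1]$. -}

module Defs where

open import Data.Bool using (Bool; true; false; if_then_else_)
open import Data.Nat as ℕ using (ℕ; zero; suc; _⊔_; _≤ᵇ_)
open import Data.Fin using (Fin; zero; suc)
open import Data.Maybe using (Maybe; just; nothing)
open import Data.Vec using (Vec; []; _∷_; lookup)
open import Data.List using (List; []; _∷_; map; concatMap)
open import Data.List.Membership.Propositional using (_∉_)
open import Data.Product using (_×_)
open import Data.Unit using (⊤)
open import Data.Integer using (+_)
open import Data.Rational using (ℚ; 0ℚ; 1ℚ; ½; _+_; _*_; _-_; _/_)

-- Decision trees over the Boolean variables x_0 … x_{n-1}.
-- node x t₀ t₁ queries x; t₀ is the 0-child, t₁ the 1-child.
data DT (n : ℕ) : Set where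
  leaf : Bool → DT n
  node : Fin n → DT n → DT n → DT n

-- Proper: no variable is queried twice on a branch
-- (vs = variables already queried on the path from the root).
ProperFrom : ∀ {n} → List (Fin n) → DT n → Set
ProperFrom vs (leaf b) = ⊤
ProperFrom vs (node x t₀ t₁) = (x ∉ vs) × ProperFrom (x ∷ vs) t₀ × ProperFrom (x ∷ vs) t₁

Proper : ∀ {n} → DT n → Set
Proper = ProperFrom []

data LeafWithin {n : ℕ} : ℕ → DT n → Set where
  here  : ∀ {k b} → LeafWithin k (leaf b)
  left  : ∀ {k x t₀ t₁} → LeafWithin k t₀ → LeafWithin (suc k) (node x t₀ t₁)
  right : ∀ {k x t₀ t₁} → LeafWithin k t₁ → LeafWithin (suc k) (node x t₀ t₁)

Clipped : ∀ {n} → ℕ → DT n → Set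
Clipped k (leaf b) = ⊤
Clipped k (node x t₀ t₁) = LeafWithin k (node x t₀ t₁) × Clipped k t₀ × Clipped k t₁

depth : ∀ {n} → DT n → ℕ
depth (leaf b) = 0
depth (node x t₀ t₁) = suc (depth t₀ ⊔ depth t₁)

-- Restrictions: nothing = * (free), just b = fixed to b.
Restriction : ℕ → Set
Restriction n = Vec (Maybe Bool) n

restrict : ∀ {n} → Restriction n → DT n → DT n
restrict ρ (leaf b) = leaf b
restrict ρ (node x t₀ t₁) with lookup ρ x
... | nothing    = node x (restrict ρ t₀) (restrict ρ t₁)
... | just false = restrict ρ t₀
... | just true  = restrict ρ t₁

allRestrictions : (n : ℕ) → List (Restriction n)
allRestrictions zero = [] ∷ []
allRestrictions (suc n) =
  concatMap (λ ρ → (nothing ∷ ρ) ∷ (just false ∷ ρ) ∷ (just true ∷ ρ) ∷ []) (allRestrictions n)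

-- Probability mass of a restriction under R_p: * with prob. p, 0 and 1 with prob. (1-p)/2 each.
weight1 : ℚ → Maybe Bool → ℚ
weight1 p nothing  = p
weight1 p (just b) = (1ℚ - p) * ½

weight : ∀ {n} → ℚ → Restriction n → ℚ
weight p [] = 1ℚ
weight p (a ∷ ρ) = weight1 p a * weight p ρ

sumℚ : List ℚ → ℚ
sumℚ [] = 0ℚ
sumℚ (q ∷ qs) = q + sumℚ qs

probDepthGE : ∀ {n} → ℚ → DT n → ℕ → ℚ
probDepthGE {n} p T t =
  sumℚ (map (λ ρ → if t ≤ᵇ depth (restrict ρ T) then weight p ρ else 0ℚ) (allRestrictions n))

_^ℚ_ : ℚ → ℕ → ℚ
q ^ℚ zero = 1ℚ
q ^ℚ suc m = q * (q ^ℚ m)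

ℕ→ℚ : ℕ → ℚ
ℕ→ℚ m = (+ m) / 1

module Submission where

-- Write P_T(t) for Pr[depth (T ↾ ρ) ≥ t] and expose the root x of T = node x t₀ t₁. With probability p
-- the variable x stays free and the depth is one more than the larger depth of the two restricted
-- children; otherwise x is fixed and the depth is that of one child. As T is proper, x does not occur
-- in the children, so
--   P_T(t+1) = p · Pr[max of the children's depths ≥ t] + ((1-p)/2) · (P_t₀(t+1) + P_t₁(t+1)),
-- and the middle probability is at most 1, and at most P_t₀(t) + P_t₁(t) by the union bound.
-- Let M = 2k2^k and q = Mp. Clippedness enters through the potential φ(j) = M - 2j2^j: if T has a leaf
-- within d decisions and d + j = k, then P_T(t+1) ≤ φ(j) p q^t. At a node, the child on the short path
-- to that leaf gets j + 1, while the other child, being k-clipped itself, starts afresh with φ(0) = M;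
-- the induction closes because 1 + (φ(j+1) + M)/2 ≤ φ(j) and (φ(j+1) + M)(1 + M/2) ≤ φ(j) M.
-- For j = 0 the bound is M p q^t = q^(t+1).

open import Defs
open import Data.Nat using (ℕ; _^_)
open import Data.Rational using (ℚ; 0ℚ; 1ℚ; _≤_; _*_)

open import Level using (0ℓ)
open import Data.Bool using (Bool; true; false; if_then_else_)
open import Data.Fin using (Fin; zero; suc)
import Data.Integer as ℤ
import Data.Integer.Properties as ℤₚ
open import Data.List using (List; []; _∷_; map; concatMap)
open import Data.List.Membership.Propositional using (_∈_)
open import Data.List.Properties using (map-cong)
open import Data.List.Relation.Unary.Any using (here; there)
open import Data.Maybe using (Maybe; just; nothing)
import Data.Nat as Nat
open Nat using (zero; suc; _⊔_; _≤ᵇ_)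
import Data.Nat.Coprimality as Coprime
import Data.Nat.Properties as ℕₚ
import Data.Nat.Tactic.RingSolver as ℕ-Solver
open import Data.Product using (_×_; _,_; proj₁; proj₂)
open import Data.Rational using (_+_; _-_; -_; ½; mkℚ; *≤*; _/_; nonNegative)
open import Data.Rational.Properties
open import Data.Sum using (inj₁; inj₂)
open import Data.Vec using ([]; _∷_; lookup; _[_]≔_)
open import Data.Vec.Properties using (lookup∘update; lookup∘update′)
open import Relation.Binary.PropositionalEquality
open import Relation.Nullary.Decidable using (dec⇒maybe)
open import Tactic.RingSolver using (solve-∀)
open import Tactic.RingSolver.Core.AlmostCommutativeRing using (AlmostCommutativeRing; fromCommutativeRing)

ℚ-ring : AlmostCommutativeRing 0ℓ 0ℓ
ℚ-ring = fromCommutativeRing +-*-commutativeRing (λ x → dec⇒maybe (0ℚ ≟ x))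

p≤p+q : ∀ {p q} → 0ℚ ≤ q → p ≤ p + q
p≤p+q {p} {q} 0≤q = subst (_≤ p + q) (+-identityʳ p) (+-monoʳ-≤ p 0≤q)

p≤q+p : ∀ {p q} → 0ℚ ≤ q → p ≤ q + p
p≤q+p {p} {q} 0≤q = subst (p ≤_) (+-comm p q) (p≤p+q 0≤q)

≤-by-slack : ∀ {p q r} → q ≡ p + r → 0ℚ ≤ r → p ≤ q
≤-by-slack q≡p+r 0≤r = subst (_ ≤_) (sym q≡p+r) (p≤p+q 0≤r)

0≤q-p : ∀ {p q} → p ≤ q → 0ℚ ≤ q - p
0≤q-p {p} {q} p≤q = subst (_≤ q - p) (+-inverseʳ p) (+-monoˡ-≤ (- p) p≤q)

*-nonNeg : ∀ {p q} → 0ℚ ≤ p → 0ℚ ≤ q → 0ℚ ≤ p * q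
*-nonNeg {p} {q} 0≤p 0≤q =
  nonNegative⁻¹ _ {{nonNeg*nonNeg⇒nonNeg p {{nonNegative 0≤p}} q {{nonNegative 0≤q}}}}

*-monoˡ-≤-0≤ : ∀ {r p q} → 0ℚ ≤ r → p ≤ q → r * p ≤ r * q
*-monoˡ-≤-0≤ {r} 0≤r = *-monoˡ-≤-nonNeg r {{nonNegative 0≤r}}

*-monoʳ-≤-0≤ : ∀ {r p q} → 0ℚ ≤ r → p ≤ q → p * r ≤ q * r
*-monoʳ-≤-0≤ {r} 0≤r = *-monoʳ-≤-nonNeg r {{nonNegative 0≤r}}

^ℚ-nonNeg : ∀ {q} → 0ℚ ≤ q → ∀ t → 0ℚ ≤ q ^ℚ t
^ℚ-nonNeg 0≤q zero    = nonNegative⁻¹ 1ℚ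
^ℚ-nonNeg 0≤q (suc t) = *-nonNeg 0≤q (^ℚ-nonNeg 0≤q t)

ℕ→ℚ≡mkℚ : ∀ m → ℕ→ℚ m ≡ mkℚ (ℤ.+ m) 0 (Coprime.sym (Coprime.1-coprimeTo m))
ℕ→ℚ≡mkℚ m = normalize-coprime _

ℕ→ℚ-+ : ∀ m n → ℕ→ℚ (m Nat.+ n) ≡ ℕ→ℚ m + ℕ→ℚ n
ℕ→ℚ-+ m n rewrite ℕ→ℚ≡mkℚ m | ℕ→ℚ≡mkℚ n | ℤₚ.*-identityʳ (ℤ.+ m) | ℤₚ.*-identityʳ (ℤ.+ n) = refl

ℕ→ℚ-* : ∀ m n → ℕ→ℚ (m Nat.* n) ≡ ℕ→ℚ m * ℕ→ℚ n
ℕ→ℚ-* m n rewrite ℕ→ℚ≡mkℚ m | ℕ→ℚ≡mkℚ n = cong (_/ 1) (sym (ℤₚ.+◃n≡+n (m Nat.* n)))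

ℕ→ℚ-mono-≤ : ∀ {m n} → m Nat.≤ n → ℕ→ℚ m ≤ ℕ→ℚ n
ℕ→ℚ-mono-≤ {m} {n} m≤n rewrite ℕ→ℚ≡mkℚ m | ℕ→ℚ≡mkℚ n =
  *≤* (ℤₚ.*-monoʳ-≤-nonNeg (ℤ.+ 1) (ℤ.+≤+ m≤n))

ℕ→ℚ-nonNeg : ∀ n → 0ℚ ≤ ℕ→ℚ n
ℕ→ℚ-nonNeg n = ℕ→ℚ-mono-≤ {0} {n} Nat.z≤n

module _ (p : ℚ) where

  fixProb : ℚ
  fixProb = (1ℚ - p) * ½

  𝔼₁ : (Maybe Bool → ℚ) → ℚ
  𝔼₁ f = p * f nothing + (fixProb * f (just false) + fixProb * f (just true))

  𝔼 : ∀ {n} → (Restriction n → ℚ) → ℚ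
  𝔼 {zero}  f = f []
  𝔼 {suc n} f = 𝔼 (λ ρ → 𝔼₁ (λ a → f (a ∷ ρ)))

  𝔼₁-cong : ∀ {f g} → (∀ a → f a ≡ g a) → 𝔼₁ f ≡ 𝔼₁ g
  𝔼₁-cong f≡g = cong₂ _+_ (cong (p *_) (f≡g nothing))
    (cong₂ _+_ (cong (fixProb *_) (f≡g (just false))) (cong (fixProb *_) (f≡g (just true))))

  𝔼₁-const : ∀ c → 𝔼₁ (λ _ → c) ≡ c
  𝔼₁-const = identity p
    where
    identity : ∀ r c → r * c + ((1ℚ - r) * ½ * c + (1ℚ - r) * ½ * c) ≡ c
    identity = solve-∀ ℚ-ring

  𝔼₁-+ : ∀ f g → 𝔼₁ (λ a → f a + g a) ≡ 𝔼₁ f + 𝔼₁ g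
  𝔼₁-+ f g = identity p fixProb (f nothing) (f (just false)) (f (just true))
                                  (g nothing) (g (just false)) (g (just true))
    where
    identity : ∀ r w a b c a′ b′ c′ →
      r * (a + a′) + (w * (b + b′) + w * (c + c′)) ≡ (r * a + (w * b + w * c)) + (r * a′ + (w * b′ + w * c′))
    identity = solve-∀ ℚ-ring

  𝔼₁-* : ∀ c f → 𝔼₁ (λ a → c * f a) ≡ c * 𝔼₁ f
  𝔼₁-* c f = identity p fixProb c (f nothing) (f (just false)) (f (just true))
    where
    identity : ∀ r w c a b d → r * (c * a) + (w * (c * b) + w * (c * d)) ≡ c * (r * a + (w * b + w * d))
    identity = solve-∀ ℚ-ring

  𝔼-cong : ∀ {n} {f g : Restriction n → ℚ} → (∀ ρ → f ρ ≡ g ρ) → 𝔼 f ≡ 𝔼 g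
  𝔼-cong {zero}  f≡g = f≡g []
  𝔼-cong {suc n} f≡g = 𝔼-cong (λ ρ → 𝔼₁-cong (λ a → f≡g (a ∷ ρ)))

  𝔼-const : ∀ {n} c → 𝔼 {n} (λ _ → c) ≡ c
  𝔼-const {zero}  c = refl
  𝔼-const {suc n} c = trans (𝔼-cong {n} (λ _ → 𝔼₁-const c)) (𝔼-const {n} c)

  𝔼-+ : ∀ {n} (f g : Restriction n → ℚ) → 𝔼 (λ ρ → f ρ + g ρ) ≡ 𝔼 f + 𝔼 g
  𝔼-+ {zero}  f g = refl
  𝔼-+ {suc n} f g = trans (𝔼-cong {n} (λ ρ → 𝔼₁-+ (λ a → f (a ∷ ρ)) (λ a → g (a ∷ ρ))))
                          (𝔼-+ (λ ρ → 𝔼₁ (λ a → f (a ∷ ρ))) (λ ρ → 𝔼₁ (λ a → g (a ∷ ρ))))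

  𝔼-* : ∀ {n} c (f : Restriction n → ℚ) → 𝔼 (λ ρ → c * f ρ) ≡ c * 𝔼 f
  𝔼-* {zero}  c f = refl
  𝔼-* {suc n} c f = trans (𝔼-cong {n} (λ ρ → 𝔼₁-* c (λ a → f (a ∷ ρ))))
                          (𝔼-* c (λ ρ → 𝔼₁ (λ a → f (a ∷ ρ))))

  𝔼-𝔼₁ : ∀ {n} (h : Maybe Bool → Restriction n → ℚ) → 𝔼 (λ ρ → 𝔼₁ (λ a → h a ρ)) ≡ 𝔼₁ (λ a → 𝔼 (h a))
  𝔼-𝔼₁ h = begin
      𝔼 (λ ρ → p * h₋ ρ + (fixProb * h₀ ρ + fixProb * h₁ ρ))
    ≡⟨ 𝔼-+ (λ ρ → p * h₋ ρ) _ ⟩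
      𝔼 (λ ρ → p * h₋ ρ) + 𝔼 (λ ρ → fixProb * h₀ ρ + fixProb * h₁ ρ)
    ≡⟨ cong₂ _+_ (𝔼-* p h₋) (𝔼-+ (λ ρ → fixProb * h₀ ρ) _) ⟩
      p * 𝔼 h₋ + (𝔼 (λ ρ → fixProb * h₀ ρ) + 𝔼 (λ ρ → fixProb * h₁ ρ))
    ≡⟨ cong ((p * 𝔼 h₋) +_) (cong₂ _+_ (𝔼-* fixProb h₀) (𝔼-* fixProb h₁)) ⟩
      𝔼₁ (λ a → 𝔼 (h a)) ∎
    where
    open ≡-Reasoning
    h₋ = h nothing
    h₀ = h (just false)
    h₁ = h (just true)

  𝔼-split : ∀ {n} (x : Fin n) (f : Restriction n → ℚ) → 𝔼 f ≡ 𝔼₁ (λ c → 𝔼 (λ ρ → f (ρ [ x ]≔ c)))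
  𝔼-split zero    f = trans (𝔼-𝔼₁ (λ a ρ → f (a ∷ ρ)))
                            (𝔼₁-cong (λ c → 𝔼-cong (λ ρ → sym (𝔼₁-const (f (c ∷ ρ))))))
  𝔼-split (suc x) f = 𝔼-split x (λ ρ → 𝔼₁ (λ a → f (a ∷ ρ)))

  sum-expand : ∀ {n} (L : List (Restriction n)) (f : Restriction (suc n) → ℚ) →
    sumℚ (map (λ σ → weight p σ * f σ)
               (concatMap (λ ρ → (nothing ∷ ρ) ∷ (just false ∷ ρ) ∷ (just true ∷ ρ) ∷ []) L))
    ≡ sumℚ (map (λ ρ → weight p ρ * 𝔼₁ (λ a → f (a ∷ ρ))) L)
  sum-expand []      f = refl
  sum-expand (ρ ∷ L) f =
    trans (identity p fixProb (weight p ρ) (f (nothing ∷ ρ)) (f (just false ∷ ρ)) (f (just true ∷ ρ)) _)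
          (cong ((weight p ρ * 𝔼₁ (λ a → f (a ∷ ρ))) +_) (sum-expand L f))
    where
    identity : ∀ r w W a b c s → r * W * a + (w * W * b + (w * W * c + s)) ≡ W * (r * a + (w * b + w * c)) + s
    identity = solve-∀ ℚ-ring

  sum-allRestrictions : ∀ n (f : Restriction n → ℚ) →
    sumℚ (map (λ ρ → weight p ρ * f ρ) (allRestrictions n)) ≡ 𝔼 f
  sum-allRestrictions zero    f = trans (+-identityʳ _) (*-identityˡ (f []))
  sum-allRestrictions (suc n) f = trans (sum-expand (allRestrictions n) f) (sum-allRestrictions n _)

module _ {p : ℚ} (0≤p : 0ℚ ≤ p) (p≤1 : p ≤ 1ℚ) where

  fixProb-nonNeg : 0ℚ ≤ fixProb p
  fixProb-nonNeg = *-nonNeg (0≤q-p p≤1) (nonNegative⁻¹ ½)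

  fixProb≤½ : fixProb p ≤ ½
  fixProb≤½ = *-monoʳ-≤-0≤ (nonNegative⁻¹ ½) 1-p≤1
    where
    1-p≤1 : 1ℚ - p ≤ 1ℚ
    1-p≤1 = ≤-by-slack (identity p) 0≤p
      where
      identity : ∀ r → 1ℚ ≡ (1ℚ - r) + r
      identity = solve-∀ ℚ-ring

  𝔼₁-mono : ∀ {f g} → (∀ a → f a ≤ g a) → 𝔼₁ p f ≤ 𝔼₁ p g
  𝔼₁-mono f≤g = +-mono-≤ (*-monoˡ-≤-0≤ 0≤p (f≤g nothing))
    (+-mono-≤ (*-monoˡ-≤-0≤ fixProb-nonNeg (f≤g (just false))) (*-monoˡ-≤-0≤ fixProb-nonNeg (f≤g (just true))))

  𝔼-mono : ∀ {n} {f g : Restriction n → ℚ} → (∀ ρ → f ρ ≤ g ρ) → 𝔼 p f ≤ 𝔼 p g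
  𝔼-mono {zero}  f≤g = f≤g []
  𝔼-mono {suc n} f≤g = 𝔼-mono {n} (λ ρ → 𝔼₁-mono (λ a → f≤g (a ∷ ρ)))

𝟙 : Bool → ℚ
𝟙 b = if b then 1ℚ else 0ℚ

𝟙-nonNeg : ∀ b → 0ℚ ≤ 𝟙 b
𝟙-nonNeg true  = nonNegative⁻¹ 1ℚ
𝟙-nonNeg false = ≤-refl

𝟙≤1 : ∀ b → 𝟙 b ≤ 1ℚ
𝟙≤1 true  = ≤-refl
𝟙≤1 false = nonNegative⁻¹ 1ℚ

module _ {p : ℚ} (0≤p : 0ℚ ≤ p) (p≤1 : p ≤ 1ℚ) {n : ℕ} (b : Restriction n → Bool) where

  𝔼-𝟙-nonNeg : 0ℚ ≤ 𝔼 p (λ ρ → 𝟙 (b ρ))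
  𝔼-𝟙-nonNeg = subst (_≤ 𝔼 p (λ ρ → 𝟙 (b ρ))) (𝔼-const p {n} 0ℚ) (𝔼-mono 0≤p p≤1 (λ ρ → 𝟙-nonNeg (b ρ)))

  𝔼-𝟙≤1 : 𝔼 p (λ ρ → 𝟙 (b ρ)) ≤ 1ℚ
  𝔼-𝟙≤1 = subst (𝔼 p (λ ρ → 𝟙 (b ρ)) ≤_) (𝔼-const p {n} 1ℚ) (𝔼-mono 0≤p p≤1 (λ ρ → 𝟙≤1 (b ρ)))

𝟙-≤ᵇ-⊔ : ∀ t a b → 𝟙 (t ≤ᵇ a ⊔ b) ≤ 𝟙 (t ≤ᵇ a) + 𝟙 (t ≤ᵇ b)
𝟙-≤ᵇ-⊔ t a b with ℕₚ.⊔-sel a b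
... | inj₁ a⊔b≡a rewrite a⊔b≡a = p≤p+q (𝟙-nonNeg (t ≤ᵇ b))
... | inj₂ a⊔b≡b rewrite a⊔b≡b = p≤q+p (𝟙-nonNeg (t ≤ᵇ a))

suc-≤ᵇ-suc : ∀ t m → (suc t ≤ᵇ suc m) ≡ (t ≤ᵇ m)
suc-≤ᵇ-suc zero    m = refl
suc-≤ᵇ-suc (suc t) m = refl

module _ {n : ℕ} (σ : Restriction n) (z : Fin n) (t₀ t₁ : DT n) where

  restrict-node-free : lookup σ z ≡ nothing → restrict σ (node z t₀ t₁) ≡ node z (restrict σ t₀) (restrict σ t₁)
  restrict-node-free σz≡* with lookup σ z | σz≡*
  ... | _ | refl = refl

  restrict-node-fixed : ∀ {b} → lookup σ z ≡ just b → restrict σ (node z t₀ t₁) ≡ restrict σ (if b then t₁ else t₀)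
  restrict-node-fixed σz≡b with lookup σ z | σz≡b
  ... | just false | refl = refl
  ... | just true  | refl = refl

  restrict-node-cong : ∀ ρ → lookup σ z ≡ lookup ρ z → restrict σ t₀ ≡ restrict ρ t₀ → restrict σ t₁ ≡ restrict ρ t₁ →
    restrict σ (node z t₀ t₁) ≡ restrict ρ (node z t₀ t₁)
  restrict-node-cong ρ σz≡ρz e₀ e₁ with lookup σ z | lookup ρ z | σz≡ρz
  ... | nothing    | _ | refl = cong₂ (node z) e₀ e₁
  ... | just false | _ | refl = e₀
  ... | just true  | _ | refl = e₁

restrict-update-visited : ∀ {n vs} {x : Fin n} (T : DT n) → ProperFrom vs T → x ∈ vs →
  ∀ ρ c → restrict (ρ [ x ]≔ c) T ≡ restrict ρ T
restrict-update-visited (leaf b) _ _ ρ c = refl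
restrict-update-visited {x = x} (node z t₀ t₁) (z∉vs , pr₀ , pr₁) x∈vs ρ c =
  restrict-node-cong (ρ [ x ]≔ c) z t₀ t₁ ρ (lookup∘update′ (λ { refl → z∉vs x∈vs }) ρ c)
    (restrict-update-visited t₀ pr₀ (there x∈vs) ρ c) (restrict-update-visited t₁ pr₁ (there x∈vs) ρ c)

module _ {n vs} {x : Fin n} {t₀ t₁ : DT n} (pr : ProperFrom vs (node x t₀ t₁)) (ρ : Restriction n) where

  private
    pr₀ : ProperFrom (x ∷ vs) t₀
    pr₀ = proj₁ (proj₂ pr)
    pr₁ : ProperFrom (x ∷ vs) t₁
    pr₁ = proj₂ (proj₂ pr)

  restrict-free-root : restrict (ρ [ x ]≔ nothing) (node x t₀ t₁) ≡ node x (restrict ρ t₀) (restrict ρ t₁)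
  restrict-free-root = trans (restrict-node-free (ρ [ x ]≔ nothing) x t₀ t₁ (lookup∘update x ρ nothing))
    (cong₂ (node x) (restrict-update-visited t₀ pr₀ (here refl) ρ nothing)
                    (restrict-update-visited t₁ pr₁ (here refl) ρ nothing))

  restrict-fixed-root : ∀ b → restrict (ρ [ x ]≔ just b) (node x t₀ t₁) ≡ restrict ρ (if b then t₁ else t₀)
  restrict-fixed-root b = trans (restrict-node-fixed (ρ [ x ]≔ just b) x t₀ t₁ (lookup∘update x ρ (just b))) (visited b)
    where
    visited : ∀ b → restrict (ρ [ x ]≔ just b) (if b then t₁ else t₀) ≡ restrict ρ (if b then t₁ else t₀)
    visited false = restrict-update-visited t₀ pr₀ (here refl) ρ (just false)
    visited true  = restrict-update-visited t₁ pr₁ (here refl) ρ (just true)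

module _ (p : ℚ) where

  depthTail : ∀ {n} → DT n → ℕ → ℚ
  depthTail T t = 𝔼 p (λ ρ → 𝟙 (t ≤ᵇ depth (restrict ρ T)))

  maxDepthTail : ∀ {n} → DT n → DT n → ℕ → ℚ
  maxDepthTail t₀ t₁ t = 𝔼 p (λ ρ → 𝟙 (t ≤ᵇ depth (restrict ρ t₀) ⊔ depth (restrict ρ t₁)))

  probDepthGE≡depthTail : ∀ {n} (T : DT n) t → probDepthGE p T t ≡ depthTail T t
  probDepthGE≡depthTail {n} T t =
    trans (cong sumℚ (map-cong (λ ρ → if-weight (t ≤ᵇ depth (restrict ρ T)) (weight p ρ)) (allRestrictions n)))
          (sum-allRestrictions p n _)
    where
    if-weight : ∀ b w → (if b then w else 0ℚ) ≡ w * 𝟙 b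
    if-weight true  w = sym (*-identityʳ w)
    if-weight false w = sym (*-zeroʳ w)

  depthTail-node : ∀ {n vs} {x : Fin n} {t₀ t₁} → ProperFrom vs (node x t₀ t₁) → ∀ t →
    depthTail (node x t₀ t₁) (suc t) ≡ p * maxDepthTail t₀ t₁ t + fixProb p * (depthTail t₀ (suc t) + depthTail t₁ (suc t))
  depthTail-node {x = x} {t₀} {t₁} pr t = begin
      depthTail (node x t₀ t₁) (suc t)
    ≡⟨ 𝔼-split p x _ ⟩
      𝔼₁ p (λ c → 𝔼 p (λ ρ → 𝟙 (suc t ≤ᵇ depth (restrict (ρ [ x ]≔ c) (node x t₀ t₁)))))
    ≡⟨ 𝔼₁-cong p (λ c → 𝔼-cong p (tail-at-root c)) ⟩
      p * maxDepthTail t₀ t₁ t + (fixProb p * depthTail t₀ (suc t) + fixProb p * depthTail t₁ (suc t))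
    ≡⟨ cong ((p * maxDepthTail t₀ t₁ t) +_) (sym (*-distribˡ-+ (fixProb p) _ _)) ⟩
      p * maxDepthTail t₀ t₁ t + fixProb p * (depthTail t₀ (suc t) + depthTail t₁ (suc t)) ∎
    where
    open ≡-Reasoning
    tail-at : Maybe Bool → Restriction _ → ℚ
    tail-at nothing      ρ = 𝟙 (t ≤ᵇ depth (restrict ρ t₀) ⊔ depth (restrict ρ t₁))
    tail-at (just false) ρ = 𝟙 (suc t ≤ᵇ depth (restrict ρ t₀))
    tail-at (just true)  ρ = 𝟙 (suc t ≤ᵇ depth (restrict ρ t₁))
    tail-at-root : ∀ c ρ → 𝟙 (suc t ≤ᵇ depth (restrict (ρ [ x ]≔ c) (node x t₀ t₁))) ≡ tail-at c ρ
    tail-at-root nothing ρ = trans (cong (λ T → 𝟙 (suc t ≤ᵇ depth T)) (restrict-free-root pr ρ))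
                                   (cong 𝟙 (suc-≤ᵇ-suc t _))
    tail-at-root (just false) ρ = cong (λ T → 𝟙 (suc t ≤ᵇ depth T)) (restrict-fixed-root pr ρ false)
    tail-at-root (just true)  ρ = cong (λ T → 𝟙 (suc t ≤ᵇ depth T)) (restrict-fixed-root pr ρ true)

module _ {p : ℚ} (0≤p : 0ℚ ≤ p) (p≤1 : p ≤ 1ℚ) {n : ℕ} where

  depthTail-nonNeg : ∀ (T : DT n) t → 0ℚ ≤ depthTail p T t
  depthTail-nonNeg T t = 𝔼-𝟙-nonNeg 0≤p p≤1 (λ ρ → t ≤ᵇ depth (restrict ρ T))

  depthTail≤1 : ∀ (T : DT n) t → depthTail p T t ≤ 1ℚ
  depthTail≤1 T t = 𝔼-𝟙≤1 0≤p p≤1 (λ ρ → t ≤ᵇ depth (restrict ρ T))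

  maxDepthTail≤1 : ∀ (t₀ t₁ : DT n) t → maxDepthTail p t₀ t₁ t ≤ 1ℚ
  maxDepthTail≤1 t₀ t₁ t = 𝔼-𝟙≤1 0≤p p≤1 (λ ρ → t ≤ᵇ depth (restrict ρ t₀) ⊔ depth (restrict ρ t₁))

  maxDepthTail≤+ : ∀ (t₀ t₁ : DT n) t → maxDepthTail p t₀ t₁ t ≤ depthTail p t₀ t + depthTail p t₁ t
  maxDepthTail≤+ t₀ t₁ t = subst (maxDepthTail p t₀ t₁ t ≤_)
    (𝔼-+ p (λ ρ → 𝟙 (t ≤ᵇ depth (restrict ρ t₀))) (λ ρ → 𝟙 (t ≤ᵇ depth (restrict ρ t₁))))
    (𝔼-mono 0≤p p≤1 (λ ρ → 𝟙-≤ᵇ-⊔ t (depth (restrict ρ t₀)) (depth (restrict ρ t₁))))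

TailBound : ∀ {n} → ℚ → ℚ → ℚ → DT n → Set
TailBound p q α T = ∀ t → depthTail p T (suc t) ≤ α * p * q ^ℚ t

-- The conditions under which child bounds α₀, α₁ with α₀ + α₁ = S give the bound α at the node: the
-- first covers t = 0, where the free-root term is bounded by 1, the second t ≥ 1, via the union bound.
Propagates : ℚ → ℚ → ℚ → ℚ → Set
Propagates p q S α = (1ℚ + ½ * S ≤ α) × (S * (p + ½ * q) ≤ α * q)

module _ {p : ℚ} (0≤p : 0ℚ ≤ p) (p≤1 : p ≤ 1ℚ) {n vs} {x : Fin n} {t₀ t₁ : DT n}
         (pr : ProperFrom vs (node x t₀ t₁)) where

  depthTail-node-≤ : ∀ {t X Y} → maxDepthTail p t₀ t₁ t ≤ X → depthTail p t₀ (suc t) + depthTail p t₁ (suc t) ≤ Y →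
    depthTail p (node x t₀ t₁) (suc t) ≤ p * X + ½ * Y
  depthTail-node-≤ {t} max≤X sum≤Y = subst (_≤ _) (sym (depthTail-node p pr t))
    (+-mono-≤ (*-monoˡ-≤-0≤ 0≤p max≤X)
              (≤-trans (*-monoʳ-≤-0≤ sum-nonNeg (fixProb≤½ 0≤p p≤1)) (*-monoˡ-≤-0≤ (nonNegative⁻¹ ½) sum≤Y)))
    where
    sum-nonNeg : 0ℚ ≤ depthTail p t₀ (suc t) + depthTail p t₁ (suc t)
    sum-nonNeg = +-mono-≤ (depthTail-nonNeg 0≤p p≤1 t₀ (suc t)) (depthTail-nonNeg 0≤p p≤1 t₁ (suc t))

  tailBound-node : ∀ {q α₀ α₁ α} → 0ℚ ≤ q → Propagates p q (α₀ + α₁) α →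
    TailBound p q α₀ t₀ → TailBound p q α₁ t₁ → TailBound p q α (node x t₀ t₁)
  tailBound-node {q} {α₀} {α₁} {α} 0≤q (first-step , _) B₀ B₁ zero = begin
      depthTail p (node x t₀ t₁) 1
    ≤⟨ depthTail-node-≤ (maxDepthTail≤1 0≤p p≤1 t₀ t₁ 0) (+-mono-≤ (B₀ 0) (B₁ 0)) ⟩
      p * 1ℚ + ½ * (α₀ * p * 1ℚ + α₁ * p * 1ℚ)
    ≡⟨ identity p α₀ α₁ ⟩
      (1ℚ + ½ * (α₀ + α₁)) * p
    ≤⟨ *-monoʳ-≤-0≤ 0≤p first-step ⟩
      α * p
    ≡⟨ sym (*-identityʳ (α * p)) ⟩
      α * p * 1ℚ ∎
    where
    open ≤-Reasoning
    identity : ∀ p a b → p * 1ℚ + ½ * (a * p * 1ℚ + b * p * 1ℚ) ≡ (1ℚ + ½ * (a + b)) * p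
    identity = solve-∀ ℚ-ring
  tailBound-node {q} {α₀} {α₁} {α} 0≤q (_ , later-steps) B₀ B₁ (suc t) = begin
      depthTail p (node x t₀ t₁) (suc (suc t))
    ≤⟨ depthTail-node-≤ (≤-trans (maxDepthTail≤+ 0≤p p≤1 t₀ t₁ (suc t)) (+-mono-≤ (B₀ t) (B₁ t)))
                        (+-mono-≤ (B₀ (suc t)) (B₁ (suc t))) ⟩
      p * (α₀ * p * Q + α₁ * p * Q) + ½ * (α₀ * p * (q * Q) + α₁ * p * (q * Q))
    ≡⟨ identity₁ p q Q α₀ α₁ ⟩
      (α₀ + α₁) * (p + ½ * q) * (p * Q)
    ≤⟨ *-monoʳ-≤-0≤ (*-nonNeg 0≤p (^ℚ-nonNeg 0≤q t)) later-steps ⟩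
      α * q * (p * Q)
    ≡⟨ identity₂ p q Q α ⟩
      α * p * (q * Q) ∎
    where
    open ≤-Reasoning
    Q = q ^ℚ t
    identity₁ : ∀ p q Q a b → p * (a * p * Q + b * p * Q) + ½ * (a * p * (q * Q) + b * p * (q * Q))
                            ≡ (a + b) * (p + ½ * q) * (p * Q)
    identity₁ = solve-∀ ℚ-ring
    identity₂ : ∀ p q Q a → a * q * (p * Q) ≡ a * p * (q * Q)
    identity₂ = solve-∀ ℚ-ring

clipped⇒leafWithin : ∀ {n k} {T : DT n} → Clipped k T → LeafWithin k T
clipped⇒leafWithin {T = leaf b}         _          = here
clipped⇒leafWithin {T = node x t₀ t₁} (lw , _ , _) = lw

κ : ℕ → ℕ
κ j = 2 Nat.* j Nat.* 2 ^ j

κ-mono-≤ : ∀ {i j} → i Nat.≤ j → κ i Nat.≤ κ j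
κ-mono-≤ i≤j = ℕₚ.*-mono-≤ (ℕₚ.*-monoʳ-≤ 2 i≤j) (ℕₚ.^-monoʳ-≤ 2 i≤j)

ℕ→ℚ-κ-suc : ∀ j → ℕ→ℚ (κ (suc j)) ≡ ℕ→ℚ 2 * ℕ→ℚ (κ j) + ℕ→ℚ 4 * ℕ→ℚ (2 ^ j)
ℕ→ℚ-κ-suc j = begin
    ℕ→ℚ (κ (suc j))
  ≡⟨ cong ℕ→ℚ (identity j (2 ^ j)) ⟩
    ℕ→ℚ (2 Nat.* κ j Nat.+ 4 Nat.* 2 ^ j)
  ≡⟨ ℕ→ℚ-+ (2 Nat.* κ j) (4 Nat.* 2 ^ j) ⟩
    ℕ→ℚ (2 Nat.* κ j) + ℕ→ℚ (4 Nat.* 2 ^ j)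
  ≡⟨ cong₂ _+_ (ℕ→ℚ-* 2 (κ j)) (ℕ→ℚ-* 4 (2 ^ j)) ⟩
    ℕ→ℚ 2 * ℕ→ℚ (κ j) + ℕ→ℚ 4 * ℕ→ℚ (2 ^ j) ∎
  where
  open ≡-Reasoning
  identity : ∀ j u → 2 Nat.* suc j Nat.* (2 Nat.* u) ≡ 2 Nat.* (2 Nat.* j Nat.* u) Nat.+ 4 Nat.* u
  identity = ℕ-Solver.solve-∀

module _ (k : ℕ) where

  M : ℚ
  M = ℕ→ℚ (κ k)

  φ : ℕ → ℚ
  φ j = M - ℕ→ℚ (κ j)

  φ-nonNeg : ∀ {j} → j Nat.≤ k → 0ℚ ≤ φ j
  φ-nonNeg j≤k = 0≤q-p (ℕ→ℚ-mono-≤ (κ-mono-≤ j≤k))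

  φ0≡M : φ 0 ≡ M
  φ0≡M = identity M
    where
    identity : ∀ m → m - 0ℚ ≡ m
    identity = solve-∀ ℚ-ring

  φ-propagates : ∀ {p} → 0ℚ ≤ p → ∀ j → Propagates p (M * p) (φ (suc j) + φ 0) (φ j)
  φ-propagates {p} 0≤p j = first-step , later-steps
    where
    G = ℕ→ℚ (κ j)
    u = ℕ→ℚ (2 ^ j)
    0≤u-1 : 0ℚ ≤ u - 1ℚ
    0≤u-1 = 0≤q-p (ℕ→ℚ-mono-≤ {1} (ℕₚ.m^n>0 2 j))
    first-step : 1ℚ + ½ * (φ (suc j) + φ 0) ≤ φ j
    first-step = ≤-by-slack
      (trans (identity M G u) (cong (λ g → (1ℚ + ½ * ((M - g) + φ 0)) + (u + (u - 1ℚ))) (sym (ℕ→ℚ-κ-suc j))))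
      (+-mono-≤ (ℕ→ℚ-nonNeg (2 ^ j)) 0≤u-1)
      where
      identity : ∀ M G u → M - G ≡ (1ℚ + ½ * ((M - (ℕ→ℚ 2 * G + ℕ→ℚ 4 * u)) + (M - 0ℚ))) + (u + (u - 1ℚ))
      identity = solve-∀ ℚ-ring
    later-steps : (φ (suc j) + φ 0) * (p + ½ * (M * p)) ≤ φ j * (M * p)
    later-steps = ≤-by-slack
      (trans (identity M G u p) (cong (λ g → ((M - g) + φ 0) * (p + ½ * (M * p)) + s * p) (sym (ℕ→ℚ-κ-suc j))))
      (*-nonNeg 0≤s 0≤p)
      where
      identity : ∀ M G u p → (M - G) * (M * p)
        ≡ ((M - (ℕ→ℚ 2 * G + ℕ→ℚ 4 * u)) + (M - 0ℚ)) * (p + ½ * (M * p))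
          + (ℕ→ℚ 2 * M * (u - 1ℚ) + ℕ→ℚ 2 * G + ℕ→ℚ 4 * u) * p
      identity = solve-∀ ℚ-ring
      s = ℕ→ℚ 2 * M * (u - 1ℚ) + ℕ→ℚ 2 * G + ℕ→ℚ 4 * u
      0≤s : 0ℚ ≤ s
      0≤s = +-mono-≤ (+-mono-≤ (*-nonNeg (*-nonNeg (ℕ→ℚ-nonNeg 2) (ℕ→ℚ-nonNeg (κ k))) 0≤u-1)
                               (*-nonNeg (ℕ→ℚ-nonNeg 2) (ℕ→ℚ-nonNeg (κ j))))
                     (*-nonNeg (ℕ→ℚ-nonNeg 4) (ℕ→ℚ-nonNeg (2 ^ j)))

  module _ {p : ℚ} (0≤p : 0ℚ ≤ p) (p≤1 : p ≤ 1ℚ) where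

    0≤M*p : 0ℚ ≤ M * p
    0≤M*p = *-nonNeg (ℕ→ℚ-nonNeg (κ k)) 0≤p

    tailBound-clipped : ∀ {n vs} (T : DT n) {d} j → d Nat.+ j ≡ k →
      ProperFrom vs T → Clipped k T → LeafWithin d T → TailBound p (M * p) (φ j) T
    tailBound-clipped {n} (leaf b) {d} j d+j≡k _ _ _ t =
      subst (_≤ φ j * p * (M * p) ^ℚ t) (sym (𝔼-const p {n} 0ℚ))
        (*-nonNeg (*-nonNeg (φ-nonNeg (subst (j Nat.≤_) d+j≡k (ℕₚ.m≤n+m j d))) 0≤p) (^ℚ-nonNeg 0≤M*p t))
    tailBound-clipped (node x t₀ t₁) {suc d} j d+j≡k pr@(_ , pr₀ , pr₁) (_ , cl₀ , cl₁) (left lw₀) =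
      tailBound-node 0≤p p≤1 pr {α₀ = φ (suc j)} {α₁ = φ 0} 0≤M*p (φ-propagates 0≤p j)
        (tailBound-clipped t₀ (suc j) (trans (ℕₚ.+-suc d j) d+j≡k) pr₀ cl₀ lw₀)
        (tailBound-clipped t₁ 0 (ℕₚ.+-identityʳ k) pr₁ cl₁ (clipped⇒leafWithin cl₁))
    tailBound-clipped (node x t₀ t₁) {suc d} j d+j≡k pr@(_ , pr₀ , pr₁) (_ , cl₀ , cl₁) (right lw₁) =
      tailBound-node 0≤p p≤1 pr {α₀ = φ 0} {α₁ = φ (suc j)} 0≤M*p
        (subst (λ S → Propagates p (M * p) S (φ j)) (+-comm (φ (suc j)) (φ 0)) (φ-propagates 0≤p j))
        (tailBound-clipped t₀ 0 (ℕₚ.+-identityʳ k) pr₀ cl₀ (clipped⇒leafWithin cl₀))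
        (tailBound-clipped t₁ (suc j) (trans (ℕₚ.+-suc d j) d+j≡k) pr₁ cl₁ lw₁)

rate≡M*p : ∀ k p → ℕ→ℚ 2 * p * ℕ→ℚ k * ℕ→ℚ (2 ^ k) ≡ M k * p
rate≡M*p k p = begin
    ℕ→ℚ 2 * p * ℕ→ℚ k * ℕ→ℚ (2 ^ k)
  ≡⟨ identity (ℕ→ℚ 2) p (ℕ→ℚ k) (ℕ→ℚ (2 ^ k)) ⟩
    ℕ→ℚ 2 * ℕ→ℚ k * ℕ→ℚ (2 ^ k) * p
  ≡⟨ cong (λ m → m * ℕ→ℚ (2 ^ k) * p) (ℕ→ℚ-* 2 k) ⟨
    ℕ→ℚ (2 Nat.* k) * ℕ→ℚ (2 ^ k) * p
  ≡⟨ cong (_* p) (ℕ→ℚ-* (2 Nat.* k) (2 ^ k)) ⟨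
    M k * p ∎
  where
  open ≡-Reasoning
  identity : ∀ a p b c → a * p * b * c ≡ a * b * c * p
  identity = solve-∀ ℚ-ring

theorem6p5 : ∀ {n : ℕ} (k : ℕ) (T : DT n) → Proper T → Clipped k T →
    (p : ℚ) → 0ℚ ≤ p → p ≤ 1ℚ → (t : ℕ) →
    probDepthGE p T t ≤ (ℕ→ℚ 2 * p * ℕ→ℚ k * ℕ→ℚ (2 ^ k)) ^ℚ t
theorem6p5 k T pr cl p 0≤p p≤1 zero =
  subst (_≤ 1ℚ) (sym (probDepthGE≡depthTail p T 0)) (depthTail≤1 0≤p p≤1 T 0)
theorem6p5 k T pr cl p 0≤p p≤1 (suc t) = begin
    probDepthGE p T (suc t)
  ≡⟨ probDepthGE≡depthTail p T (suc t) ⟩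
    depthTail p T (suc t)
  ≤⟨ tailBound-clipped k 0≤p p≤1 T 0 (ℕₚ.+-identityʳ k) pr cl (clipped⇒leafWithin cl) t ⟩
    φ k 0 * p * (M k * p) ^ℚ t
  ≡⟨ cong (λ m → m * p * (M k * p) ^ℚ t) (φ0≡M k) ⟩
    M k * p * (M k * p) ^ℚ t
  ≡⟨ cong (_^ℚ suc t) (rate≡M*p k p) ⟨
    (ℕ→ℚ 2 * p * ℕ→ℚ k * ℕ→ℚ (2 ^ k)) ^ℚ suc t ∎
  where open ≤-Reasoning
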